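{- Define $f:\mathbb{N}\to\mathbb{N}$ by $f(n)=n$ if $n$ is even and $f(n)=\frac{n+1}{2}$ if $n$ is odd, and let $f^{\downarrow}(n)$ be the first even value in the sequence $f(n),f(f(n)),\dots$. Then every fence of even cardinality is locally unsymmetric, and every (upper or lower) fence of odd cardinality $n\ge3$ is retractable to the $f^{\downarrow}(n)$-fence.
   Context: An $n$-fence is a poset with $n$ elements $a_1,\dots,a_n$ whose only strict relations are between consecutive elements and alternate: $a_1<a_2>a_3<\cdots$ (lower fence) or $a_1>a_2<a_3>\cdots$ (upper fence); a fence of even cardinality is both. For a poset $X$, $\ell(X)$ is the maximal cardinality of a chain. A subset $A$ of $X$ is maximally ordered in $X$ if $|\{(a,b)\in A\times A:a<b\}|$ is maximal among subsets of $X$ of cardinality $|A|$. For $\sigma\in\mathrm{Aut}(P)$, $\Sigma(\sigma)=\{p:\sigma(p)\ne p\}$. For a finite poset $Q$ and $r\ge2$, $\sigma$ is a $(Q,r)$-generator if there are subsets $S_0,\dots,S_{r-1}\subset\Sigma(\sigma)$, each isomorphic to $Q$, which are the smallest maximally ordered subsets of $\Sigma(\sigma)$ with $\sigma(S_i)=S_{i+1\bmod r}$, $\ell(S_i)=\ell(\Sigma(\sigma))$, $\bigcup_iS_i=\Sigma(\sigma)$. Elements $a,b$ are $(Q,r,1)$-symmetric if for such $\sigma$, $a\in S_i$ and $b=\sigma^q(a)$, $1\le q<r$; $(Q,r)$-symmetry is the generated equivalence relation, and $P\oslash_rQ$ is the quotient poset ($A\le B$ iff $a\le b$ for some $a\in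 A,b\in B$). $P$ is locally symmetric if $P\oslash_rQ\ne P$ (nontrivial relation) for some finite $Q$, $r\ge2$, and locally unsymmetric otherwise. $P$ is retractable to $R$ if there is a finite sequence of nontrivial such retractions $P\oslash_{r_1}Q_1\oslash_{r_2}Q_2\cdots\cong R$ with $R\ne P$. -}

module Defs where

open import Data.Bool using (Bool; true; false; _∧_; not; if_then_else_)
open import Data.Nat using (ℕ; zero; suc; _+_; _≤_; _<_; _<?_; ⌊_/2⌋)
open import Data.Fin using (Fin; zero; suc; toℕ; fromℕ<; _≟_)
open import Data.Fin.Subset using (Subset; _∈_; _⊆_; ∣_∣)
open import Data.Fin.Permutation using (Permutation′; _⟨$⟩ʳ_)
open import Data.Vec using (lookup)
open import Data.Product using (Σ; ∃; ∃-syntax; _×_; _,_)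
open import Data.Sum using (_⊎_)
open import Function.Bundles using (_⇔_)
open import Function.Definitions using (Injective)
open import Relation.Binary.PropositionalEquality using (_≡_; _≢_)
open import Relation.Binary.Construct.Closure.Equivalence using (EqClosure)
open import Relation.Binary.Construct.Closure.Transitive using (TransClosure)
open import Relation.Nullary using (¬_; yes; no)
open import Relation.Nullary.Decidable using (⌊_⌋)

-- Finite "posets": carrier Fin n, (non-strict) order given as a Bool-valued
-- relation.  a ≤ b  iff  le a b ≡ true.

record FinRel : Set where
  constructor mkFinRel
  field
    size : ℕ
    le   : Fin size → Fin size → Bool
open FinRel public

Elem : FinRel → Set
Elem P = Fin (size P)

IsPoset : FinRel → Set
IsPoset P =
  (∀ a → le P a a ≡ true) ×
  (∀ a b → le P a b ≡ true → le P b a ≡ true → a ≡ b) ×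
  (∀ a b c → le P a b ≡ true → le P b c ≡ true → le P a c ≡ true)

lt : (P : FinRel) → Elem P → Elem P → Bool
lt P a b = le P a b ∧ not ⌊ a ≟ b ⌋

Iso : FinRel → FinRel → Set
Iso P R = Σ (Elem P → Elem R) λ g →
  Injective _≡_ _≡_ g × (∀ y → ∃[ x ] g x ≡ y) ×
  (∀ a b → le R (g a) (g b) ≡ le P a b)

-- Fences.  Elements a_1,…,a_n are represented by 0,…,n-1.
-- isLower = true : a_1 < a_2 > a_3 < …   (lower fence)
-- isLower = false: a_1 > a_2 < a_3 > …   (upper fence)

isEven : ℕ → Bool
isEven zero = true
isEven (suc zero) = false
isEven (suc (suc n)) = isEven n

Even : ℕ → Set
Even n = isEven n ≡ true

Odd : ℕ → Set
Odd n = isEven n ≡ false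

fenceLt : Bool → {n : ℕ} → Fin n → Fin n → Bool
fenceLt isLower i j =
  (⌊ Data.Nat._≟_ (toℕ j) (suc (toℕ i)) ⌋ ∧ sameParity (toℕ i)) Data.Bool.∨
  (⌊ Data.Nat._≟_ (toℕ i) (suc (toℕ j)) ⌋ ∧ not (sameParity (toℕ j)))
  where
  -- a_{k+1} < a_{k+2} holds iff (k even) for lower fences, (k odd) for upper
  sameParity : ℕ → Bool
  sameParity k = if isLower then isEven k else not (isEven k)

fence : Bool → ℕ → FinRel
fence isLower n = mkFinRel n (λ i j → ⌊ i ≟ j ⌋ Data.Bool.∨ fenceLt isLower i j)

sumFin : (n : ℕ) → (Fin n → ℕ) → ℕ
sumFin zero f = 0
sumFin (suc n) f = f zero + sumFin n (λ i → f (suc i))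

orderedPairs : (P : FinRel) → Subset (size P) → ℕ
orderedPairs P A = sumFin (size P) λ a → sumFin (size P) λ b →
  if lookup A a ∧ lookup A b ∧ lt P a b then 1 else 0

MaxOrdered : (P : FinRel) → Subset (size P) → Subset (size P) → Set
MaxOrdered P X A = A ⊆ X ×
  (∀ B → B ⊆ X → ∣ B ∣ ≡ ∣ A ∣ → orderedPairs P B ≤ orderedPairs P A)

IsChain : (P : FinRel) → Subset (size P) → Set
IsChain P C = ∀ a b → a ∈ C → b ∈ C → (le P a b ≡ true ⊎ le P b a ≡ true)

Height : (P : FinRel) → Subset (size P) → ℕ → Set
Height P X k =
  (∃[ C ] (C ⊆ X × IsChain P C × ∣ C ∣ ≡ k)) ×
  (∀ C → C ⊆ X → IsChain P C → ∣ C ∣ ≤ k)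

IsoToSub : (Q P : FinRel) → Subset (size P) → Set
IsoToSub Q P A = Σ (Elem Q → Elem P) λ g →
  Injective _≡_ _≡_ g ×
  (∀ x → x ∈ A ⇔ (∃[ y ] g y ≡ x)) ×
  (∀ a b → le P (g a) (g b) ≡ le Q a b)

IsAut : (P : FinRel) → Permutation′ (size P) → Set
IsAut P σ = ∀ a b → le P (σ ⟨$⟩ʳ a) (σ ⟨$⟩ʳ b) ≡ le P a b

Aut : FinRel → Set
Aut P = Σ (Permutation′ (size P)) (IsAut P)

app : {P : FinRel} → Aut P → Elem P → Elem P
app (σ , _) a = σ ⟨$⟩ʳ a

iter : {P : FinRel} → Aut P → ℕ → Elem P → Elem P
iter σ zero a = a
iter σ (suc q) a = app σ (iter σ q a)

moved : {P : FinRel} → Aut P → Subset (size P)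
moved σ = Data.Vec.tabulate λ p → not ⌊ app σ p ≟ p ⌋

cyc : {r : ℕ} → Fin r → Fin r
cyc {suc r} i with suc (toℕ i) <? suc r
... | yes p = fromℕ< p
... | no _ = zero

-- S_0,…,S_{r-1} satisfy all conditions except isomorphism to Q / minimality
Admissible : (P : FinRel) (σ : Aut P) (r : ℕ) → (Fin r → Subset (size P)) → Set
Admissible P σ r S =
  (∀ i → MaxOrdered P (moved σ) (S i)) ×
  (∀ i x → x ∈ S (cyc i) ⇔ (∃[ y ] (y ∈ S i × app σ y ≡ x))) ×
  (∀ i → ∃[ h ] (Height P (S i) h × Height P (moved σ) h)) ×
  (∀ x → x ∈ moved σ → ∃[ i ] x ∈ S i)

IsGenerator : (P Q : FinRel) (r : ℕ) (σ : Aut P) → (Fin r → Subset (size P)) → Set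
IsGenerator P Q r σ S =
  Admissible P σ r S ×
  (∀ i → IsoToSub Q P (S i)) ×
  (∀ S' → Admissible P σ r S' → ∀ i → size Q ≤ ∣ S' i ∣)

Sym1 : (P Q : FinRel) (r : ℕ) → Elem P → Elem P → Set
Sym1 P Q r a b = Σ (Aut P) λ σ → Σ (Fin r → Subset (size P)) λ S →
  IsGenerator P Q r σ S ×
  (∃[ i ] a ∈ S i) × (∃[ q ] (1 ≤ q × q < r × iter σ q a ≡ b))

QSym : (P Q : FinRel) (r : ℕ) → Elem P → Elem P → Set
QSym P Q r = EqClosure (Sym1 P Q r)

Nontrivial : (P Q : FinRel) (r : ℕ) → Set
Nontrivial P Q r = ∃[ a ] ∃[ b ] (a ≢ b × QSym P Q r a b)

LocallySymmetric : FinRel → Set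
LocallySymmetric P = ∃[ Q ] ∃[ r ] (IsPoset Q × 2 ≤ r × Nontrivial P Q r)

LocallyUnsymmetric : FinRel → Set
LocallyUnsymmetric P = ¬ LocallySymmetric P

-- P' is (a presentation of) the quotient P ⊘ E : there is a surjection
-- π whose fibres are the E-classes and  π a ≤ π b  iff  a' ≤ b' for some
-- a' ∈ [a], b' ∈ [b].  This determines P' up to isomorphism.
IsQuotient : (P P' : FinRel) → (Elem P → Elem P → Set) → Set
IsQuotient P P' E = Σ (Elem P → Elem P') λ π →
  (∀ y → ∃[ x ] π x ≡ y) ×
  (∀ a b → π a ≡ π b ⇔ E a b) ×
  (∀ a b → le P' (π a) (π b) ≡ true ⇔
           (∃[ a' ] ∃[ b' ] (π a' ≡ π a × π b' ≡ π b × le P a' b' ≡ true)))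

RetractStep : FinRel → FinRel → Set
RetractStep P P' = ∃[ Q ] ∃[ r ] (IsPoset Q × 2 ≤ r × Nontrivial P Q r ×
                                  IsQuotient P P' (QSym P Q r))

Retractable : FinRel → FinRel → Set
Retractable P R = TransClosure RetractStep P R × ¬ Iso P R

f : ℕ → ℕ
f n = if isEven n then n else ⌊ suc n /2⌋

fIter : ℕ → ℕ → ℕ
fIter zero n = n
fIter (suc k) n = f (fIter k n)

IsFDown : ℕ → ℕ → Set
IsFDown n m = ∃[ k ] (m ≡ fIter (suc k) n × Even m ×
                       (∀ j → j < k → Odd (fIter (suc j) n)))

{-# OPTIONS --safe #-}
-- An automorphism of a fence preserves comparability of distinct elements, i.e.
-- adjacency in the underlying path, so it is the identity or the reversal i ↦ n-1-i.
-- For even n the reversal exchanges a minimal end with a maximal one, so only the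
-- identity is left: Σ(σ) is always empty and no two elements are symmetric.
-- For n = 2k+1 the reversal ρ is an automorphism moving everything but the middle.
-- Taking r = 3 and S₀ = S₁ = S₂ = Σ(ρ) makes ρ a (Q,3)-generator, Q being the fence
-- with its middle removed; the resulting symmetry identifies each element with its
-- mirror image, and i ↦ min(i, 2k-i) presents the quotient as the (k+1)-fence of the
-- same type. Since f(2k+1) = k+1, folding while the size stays odd ends at f↓(n), and
-- an even fence of either type is isomorphic to the lower one.
module Submission where

open import Defs
open import Data.Bool using (Bool; true; false; not; _∧_; _xor_; if_then_else_; T)
open import Data.Bool.Properties
  using (not-involutive; not-distribˡ-xor; not-¬; xor-comm; xor-assoc; xor-same; xor-identityʳ)
import Data.Bool.Properties as Bool
open import Data.Unit using (tt)
open import Data.Nat using (ℕ; zero; suc; _+_; _∸_; _≤_; _<_; z≤n; s≤s; _⊓_; ⌊_/2⌋)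
import Data.Nat as ℕ
import Data.Nat.Properties as ℕ
open import Data.Nat.Induction using (<-rec)
open import Data.Fin using (Fin; zero; suc; toℕ; fromℕ<; opposite; punchIn; punchOut; inject≤)
import Data.Fin.Properties as Fin
open import Data.Fin.Permutation using (Permutation′; _⟨$⟩ʳ_; _⟨$⟩ˡ_; inverseˡ; inverseʳ)
import Data.Fin.Permutation as Perm
open import Data.Fin.Subset using (Subset; _∈_; _⊆_; ∣_∣; ⊥; ∁; ⁅_⁆)
open import Data.Fin.Subset.Properties
  using (_∈?_; _⊆?_; ∣p∣≤n; ∉⊥; anySubset?; ⊆-antisym; p⊆q⇒∣p∣≤∣q∣; ∣∁p∣≡n∸∣p∣; ∣⁅x⁆∣≡1;
         x∈⁅x⁆; x∈⁅y⁆⇒x≡y; x∈∁p⇒x∉p; x∉p⇒x∈∁p)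
open import Data.Vec using (lookup)
import Data.Vec.Properties as Vec
open import Data.Product using (∃-syntax; _×_; _,_; proj₁; proj₂)
open import Data.Sum using (_⊎_; inj₁; inj₂)
import Data.Sum
open import Function using (_∘_; id)
open import Function.Bundles using (_⇔_; mk⇔; Equivalence)
open import Function.Definitions using (Injective)
open import Relation.Binary using (tri<; tri≈; tri>)
open import Relation.Binary.PropositionalEquality
import Relation.Binary.Construct.On as On
open import Relation.Binary.Construct.Closure.Equivalence using (fold)
open import Relation.Binary.Construct.Closure.ReflexiveTransitive using (ε; _◅_)
open import Relation.Binary.Construct.Closure.Symmetric using (fwd)
open import Relation.Binary.Construct.Closure.Transitive using (TransClosure; [_]; _∷_)
open import Relation.Nullary using (¬_; yes; no; contradiction)
open import Relation.Nullary.Decidable using (Dec; _because_; ⌊_⌋; _×-dec_; _⊎-dec_; _→-dec_)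
open import Relation.Nullary.Reflects
  using (Reflects; ofʸ; ofⁿ; T-reflects; _×-reflects_; _⊎-reflects_; invert; det)

isEven-suc : ∀ n → isEven (suc n) ≡ not (isEven n)
isEven-suc zero = refl
isEven-suc (suc zero) = refl
isEven-suc (suc (suc n)) = isEven-suc n

isEven-suc-+ : ∀ m n → isEven (suc (m + n)) ≡ isEven m xor isEven n
isEven-suc-+ zero n = isEven-suc n
isEven-suc-+ (suc m) n = begin
  isEven (m + n)                 ≡⟨ not-involutive _ ⟨
  not (not (isEven (m + n)))     ≡⟨ cong not (isEven-suc (m + n)) ⟨
  not (isEven (suc (m + n)))     ≡⟨ cong not (isEven-suc-+ m n) ⟩
  not (isEven m xor isEven n)    ≡⟨ not-distribˡ-xor (isEven m) (isEven n) ⟩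
  not (isEven m) xor isEven n    ≡⟨ cong (_xor isEven n) (isEven-suc m) ⟨
  isEven (suc m) xor isEven n    ∎
  where open ≡-Reasoning

even-double : ∀ k → Even (k + k)
even-double zero = refl
even-double (suc k) rewrite ℕ.+-suc k k = even-double k

odd⇒double+1 : ∀ n → Odd n → ∃[ k ] n ≡ suc (k + k)
odd⇒double+1 (suc zero) _ = 0 , refl
odd⇒double+1 (suc (suc n)) odd with odd⇒double+1 n odd
... | k , refl = suc k , cong (2 +_) (sym (ℕ.+-suc k k))

Adjacent : ℕ → ℕ → Set
Adjacent x y = suc x ≡ y ⊎ x ≡ suc y

adjacent-sym : ∀ {x y} → Adjacent x y → Adjacent y x
adjacent-sym (inj₁ e) = inj₂ (sym e)
adjacent-sym (inj₂ e) = inj₁ (sym e)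

adjacent-irrefl : ∀ {x} → ¬ Adjacent x x
adjacent-irrefl (inj₁ e) = ℕ.1+n≢n e
adjacent-irrefl (inj₂ e) = ℕ.1+n≢n (sym e)

adjacent-zero : ∀ {y} → Adjacent 0 y → y ≡ 1
adjacent-zero (inj₁ e) = sym e

adjacent-reverse : ∀ {x x' y y'} → x + x' ≡ y + y' → Adjacent x y → Adjacent x' y'
adjacent-reverse {x} {x'} {y' = y'} e (inj₁ refl) =
  inj₂ (ℕ.+-cancelˡ-≡ x _ _ (trans e (sym (ℕ.+-suc x y'))))
adjacent-reverse {x' = x'} {y} e (inj₂ refl) =
  inj₁ (ℕ.+-cancelˡ-≡ y _ _ (trans (ℕ.+-suc y x') e))

-- The order of a fence

-- valley t x: a_(x+1) lies below its neighbours in the fence of type t. This is the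
-- Boolean called sameParity in Defs.fenceLt, so le-fence-reflects unfolds definitionally.
valley : Bool → ℕ → Bool
valley t x = if t then isEven x else not (isEven x)

valley-suc : ∀ t x → valley t (suc x) ≡ not (valley t x)
valley-suc true x = isEven-suc x
valley-suc false x = cong not (isEven-suc x)

valley-adjacent : ∀ t {x y} → Adjacent x y → valley t x ≡ not (valley t y)
valley-adjacent t {x} (inj₁ refl) = trans (sym (not-involutive _)) (cong not (sym (valley-suc t x)))
valley-adjacent t {y = y} (inj₂ refl) = valley-suc t y

valley-reverse : ∀ t {x x' n} → suc (x + x') ≡ n → valley (t xor isEven n) x' ≡ valley t x
valley-reverse t {x} {x'} refl rewrite isEven-suc-+ x x' = valley-xor t (isEven x) (isEven x')
  where
  valley-xor : ∀ t a b → (if t xor (a xor b) then b else not b) ≡ (if t then a else not a)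
  valley-xor true true true = refl
  valley-xor true true false = refl
  valley-xor true false true = refl
  valley-xor true false false = refl
  valley-xor false true true = refl
  valley-xor false true false = refl
  valley-xor false false true = refl
  valley-xor false false false = refl

FenceLe : Bool → ℕ → ℕ → Set
FenceLe t x y = x ≡ y ⊎ (Adjacent x y × T (not (valley t y)))

adjacent-peaks : ∀ t {x y} → Adjacent x y → T (not (valley t x)) → ¬ T (not (valley t y))
adjacent-peaks t adj px = peak-below (subst (T ∘ not) (valley-adjacent t adj) px)
  where
  peak-below : ∀ {b} → T (not (not b)) → ¬ T (not b)
  peak-below {true} _ ()
  peak-below {false} ()

FenceLe-antisym : ∀ t {x y} → FenceLe t x y → FenceLe t y x → x ≡ y
FenceLe-antisym t (inj₁ x≡y) _ = x≡y
FenceLe-antisym t (inj₂ _) (inj₁ y≡x) = sym y≡x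
FenceLe-antisym t (inj₂ (adj , py)) (inj₂ (_ , px)) = contradiction py (adjacent-peaks t adj px)

FenceLe-trans : ∀ t {x y z} → FenceLe t x y → FenceLe t y z → FenceLe t x z
FenceLe-trans t (inj₁ refl) y≤z = y≤z
FenceLe-trans t x≤y (inj₁ refl) = x≤y
FenceLe-trans t (inj₂ (_ , py)) (inj₂ (adj , pz)) = contradiction pz (adjacent-peaks t adj py)

FenceLe-reverse : ∀ t {n x x' y y'} → suc (x + x') ≡ n → suc (y + y') ≡ n →
                  FenceLe t x y → FenceLe (t xor isEven n) x' y'
FenceLe-reverse t {x = x} ex ey (inj₁ refl) =
  inj₁ (ℕ.+-cancelˡ-≡ x _ _ (ℕ.suc-injective (trans ex (sym ey))))
FenceLe-reverse t {x = x} {x'} {y} {y'} ex ey (inj₂ (adj , py)) =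
  inj₂ ( adjacent-reverse {x} {x'} {y} {y'} (ℕ.suc-injective (trans ex (sym ey))) adj
       , subst (T ∘ not) (sym (valley-reverse t {y} {y'} ey)) py )

comparable⇒≡⊎adjacent : ∀ t {x y} → FenceLe t x y ⊎ FenceLe t y x → x ≡ y ⊎ Adjacent x y
comparable⇒≡⊎adjacent t (inj₁ (inj₁ x≡y)) = inj₁ x≡y
comparable⇒≡⊎adjacent t (inj₁ (inj₂ (adj , _))) = inj₂ adj
comparable⇒≡⊎adjacent t (inj₂ (inj₁ y≡x)) = inj₁ (sym y≡x)
comparable⇒≡⊎adjacent t (inj₂ (inj₂ (adj , _))) = inj₂ (adjacent-sym adj)

adjacent⇒comparable : ∀ t {x y} → Adjacent x y → FenceLe t x y ⊎ FenceLe t y x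
adjacent⇒comparable t {y = y} adj with valley t y in vy
... | false = inj₁ (inj₂ (adj , tt))
... | true =
  inj₂ (inj₂ (adjacent-sym adj , subst (T ∘ not) (sym (trans (valley-adjacent t adj) (cong not vy))) tt))

reflects-map : ∀ {A B : Set} {b} → A ⇔ B → Reflects A b → Reflects B b
reflects-map A⇔B (ofʸ a) = ofʸ (Equivalence.to A⇔B a)
reflects-map A⇔B (ofⁿ ¬a) = ofⁿ (¬a ∘ Equivalence.from A⇔B)

-- ⌊_⌋ is isYes, which agrees with does only after matching on the decision.
dec-reflects : ∀ {A : Set} (d : Dec A) → Reflects A ⌊ d ⌋
dec-reflects (true because r) = r
dec-reflects (false because r) = r

le-fence-reflects : ∀ t {n} (i j : Fin n) → Reflects (FenceLe t (toℕ i) (toℕ j)) (le (fence t n) i j)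
le-fence-reflects t i j = reflects-map (mk⇔ to from)
  (dec-reflects (i Fin.≟ j) ⊎-reflects
     ((dec-reflects (toℕ j ℕ.≟ suc (toℕ i)) ×-reflects T-reflects _) ⊎-reflects
      (dec-reflects (toℕ i ℕ.≟ suc (toℕ j)) ×-reflects T-reflects _)))
  where
  Unfolded : Set
  Unfolded = i ≡ j ⊎ ((toℕ j ≡ suc (toℕ i) × T (valley t (toℕ i))) ⊎
                      (toℕ i ≡ suc (toℕ j) × T (not (valley t (toℕ j)))))
  to : Unfolded → FenceLe t (toℕ i) (toℕ j)
  to (inj₁ i≡j) = inj₁ (cong toℕ i≡j)
  to (inj₂ (inj₁ (e , v))) = inj₂ (inj₁ (sym e) , subst T (valley-adjacent t (inj₁ (sym e))) v)
  to (inj₂ (inj₂ (e , p))) = inj₂ (inj₂ e , p)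
  from : FenceLe t (toℕ i) (toℕ j) → Unfolded
  from (inj₁ e) = inj₁ (Fin.toℕ-injective e)
  from (inj₂ (inj₁ e , p)) = inj₂ (inj₁ (sym e , subst T (sym (valley-adjacent t (inj₁ e))) p))
  from (inj₂ (inj₂ e , p)) = inj₂ (inj₂ (e , p))

module _ {t : Bool} {n : ℕ} {i j : Fin n} where

  le-fence⇒ : le (fence t n) i j ≡ true → FenceLe t (toℕ i) (toℕ j)
  le-fence⇒ i≤j = invert (subst (Reflects _) i≤j (le-fence-reflects t i j))

  le-fence⇐ : FenceLe t (toℕ i) (toℕ j) → le (fence t n) i j ≡ true
  le-fence⇐ i≤j = det (le-fence-reflects t i j) (ofʸ i≤j)

le-fence-cong : ∀ t {n n'} {i j : Fin n} {i' j' : Fin n'} → toℕ i ≡ toℕ i' → toℕ j ≡ toℕ j' →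
                le (fence t n) i j ≡ le (fence t n') i' j'
le-fence-cong t {i = i} {j} {i'} {j'} ei ej =
  det (le-fence-reflects t i j)
      (subst₂ (λ x y → Reflects (FenceLe t x y) _) (sym ei) (sym ej) (le-fence-reflects t i' j'))

suc-toℕ+toℕ-opposite : ∀ {n} (i : Fin n) → suc (toℕ i + toℕ (opposite i)) ≡ n
suc-toℕ+toℕ-opposite i =
  trans (cong (λ m → suc (toℕ i + m)) (Fin.opposite-prop i)) (ℕ.m+[n∸m]≡n (Fin.toℕ<n i))

le-fence-opposite : ∀ t {n} (i j : Fin n) →
                    le (fence (t xor isEven n) n) (opposite i) (opposite j) ≡ le (fence t n) i j
le-fence-opposite t {n} i j =
  det (le-fence-reflects _ (opposite i) (opposite j)) (reflects-map (mk⇔ to from) (le-fence-reflects t i j))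
  where
  sum : ∀ (k : Fin n) → suc (toℕ (opposite k) + toℕ k) ≡ n
  sum k = trans (cong suc (ℕ.+-comm (toℕ (opposite k)) (toℕ k))) (suc-toℕ+toℕ-opposite k)
  xor-twice : (t xor isEven n) xor isEven n ≡ t
  xor-twice = trans (xor-assoc t (isEven n) (isEven n))
                    (trans (cong (t xor_) (xor-same (isEven n))) (xor-identityʳ t))
  to : FenceLe t (toℕ i) (toℕ j) → FenceLe (t xor isEven n) (toℕ (opposite i)) (toℕ (opposite j))
  to = FenceLe-reverse t (suc-toℕ+toℕ-opposite i) (suc-toℕ+toℕ-opposite j)
  from : FenceLe (t xor isEven n) (toℕ (opposite i)) (toℕ (opposite j)) → FenceLe t (toℕ i) (toℕ j)
  from = subst (λ s → FenceLe s _ _) xor-twice ∘ FenceLe-reverse (t xor isEven n) (sum i) (sum j)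

fence-isPoset : ∀ t n → IsPoset (fence t n)
fence-isPoset t _ =
  (λ i → le-fence⇐ {i = i} (inj₁ refl)) ,
  (λ i j i≤j j≤i → Fin.toℕ-injective (FenceLe-antisym t (le-fence⇒ {i = i} i≤j) (le-fence⇒ j≤i))) ,
  (λ i j k i≤j j≤k → le-fence⇐ {i = i} {k} (FenceLe-trans t (le-fence⇒ {i = i} i≤j) (le-fence⇒ {i = j} j≤k)))

le-fence-0-1 : ∀ t N → le (fence t (suc (suc N))) zero (suc zero) ≡ t
le-fence-0-1 true _ = refl
le-fence-0-1 false _ = refl

-- Automorphisms of a fence

permutation-injective : ∀ {n} (π : Permutation′ n) → Injective _≡_ _≡_ (π ⟨$⟩ʳ_)
permutation-injective π πa≡πb = trans (sym (inverseˡ π)) (trans (cong (π ⟨$⟩ˡ_) πa≡πb) (inverseˡ π))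

opposite-injective : ∀ {n} → Injective _≡_ _≡_ (opposite {n})
opposite-injective {x = a} {b} e =
  trans (sym (Fin.opposite-involutive a)) (trans (cong opposite e) (Fin.opposite-involutive b))

aut-inverse : ∀ {P} → Aut P → Aut P
aut-inverse {P} (π , π-aut) = Perm.flip π , λ a b →
  trans (sym (π-aut (π ⟨$⟩ˡ a) (π ⟨$⟩ˡ b))) (cong₂ (le P) (inverseʳ π) (inverseʳ π))

PreservesAdjacency : ∀ {n} → (Fin n → Fin n) → Set
PreservesAdjacency h = ∀ {a b} → Adjacent (toℕ a) (toℕ b) → Adjacent (toℕ (h a)) (toℕ (h b))

opposite-preservesAdjacency : ∀ {n} → PreservesAdjacency (opposite {n})
opposite-preservesAdjacency {a = a} {b} =
  adjacent-reverse (ℕ.suc-injective (trans (suc-toℕ+toℕ-opposite a) (sym (suc-toℕ+toℕ-opposite b))))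

module _ {N : ℕ} where

  path-rigid : (h : Fin (suc N) → Fin (suc N)) → Injective _≡_ _≡_ h → PreservesAdjacency h →
               toℕ (h zero) ≡ 0 → ∀ i → h i ≡ i
  path-rigid h h-injective h-adjacent h0≡0 i = Fin.toℕ-injective (proj₁ (fixed (toℕ i)) i refl)
    where
    FixedAt : ℕ → Set
    FixedAt m = ∀ i → toℕ i ≡ m → toℕ (h i) ≡ m

    fixed₀ : FixedAt 0
    fixed₀ i i≡0 = subst (λ j → toℕ (h j) ≡ 0) (sym (Fin.toℕ-injective {j = zero} i≡0)) h0≡0

    fixed₁ : FixedAt 1
    fixed₁ i i≡1 =
      adjacent-zero (subst (λ x → Adjacent x (toℕ (h i))) h0≡0 (h-adjacent {zero} {i} (inj₁ (sym i≡1))))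

    fixed₂ : ∀ m → FixedAt m → FixedAt (suc m) → FixedAt (suc (suc m))
    fixed₂ m fixed-m fixed-m+1 i i≡m+2 =
      beyond (subst (λ x → Adjacent x (toℕ (h i))) (fixed-m+1 i₁ i₁≡m+1)
                    (h-adjacent {i₁} {i} (inj₁ (trans (cong suc i₁≡m+1) (sym i≡m+2)))))
      where
      m+1<n : suc m < suc N
      m+1<n = ℕ.<-trans (ℕ.n<1+n (suc m)) (subst (_< suc N) i≡m+2 (Fin.toℕ<n i))
      i₁ i₀ : Fin (suc N)
      i₁ = fromℕ< m+1<n
      i₀ = fromℕ< (ℕ.<-trans (ℕ.n<1+n m) m+1<n)
      i₁≡m+1 : toℕ i₁ ≡ suc m
      i₁≡m+1 = Fin.toℕ-fromℕ< m+1<n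
      i₀≡m : toℕ i₀ ≡ m
      i₀≡m = Fin.toℕ-fromℕ< _
      beyond : Adjacent (suc m) (toℕ (h i)) → toℕ (h i) ≡ suc (suc m)
      beyond (inj₁ e) = sym e
      beyond (inj₂ e) = contradiction (trans (sym i₀≡m) (trans (cong toℕ (sym i≡i₀)) i≡m+2)) (ℕ.m≢1+n+m m {1})
        where
        i≡i₀ : i ≡ i₀
        i≡i₀ = h-injective (Fin.toℕ-injective (trans (sym (ℕ.suc-injective e)) (sym (fixed-m i₀ i₀≡m))))

    fixed : ∀ m → FixedAt m × FixedAt (suc m)
    fixed zero = fixed₀ , fixed₁
    fixed (suc m) with fixed m
    ... | fixed-m , fixed-m+1 = fixed-m+1 , fixed₂ m fixed-m fixed-m+1

  -- If π 0 were an inner vertex, both of its neighbours would pull back to 1,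
  -- the only neighbour of 0.
  path-endpoint : (π : Permutation′ (suc N)) → PreservesAdjacency (π ⟨$⟩ˡ_) →
                  toℕ (π ⟨$⟩ʳ zero) ≡ 0 ⊎ toℕ (π ⟨$⟩ʳ zero) ≡ N
  path-endpoint π π⁻¹-adjacent with toℕ (π ⟨$⟩ʳ zero) in π0≡
  ... | zero = inj₁ refl
  ... | suc x with suc x ℕ.≟ N
  ...   | yes x+1≡N = inj₂ x+1≡N
  ...   | no x+1≢N =
    contradiction (trans (sym below≡x) (trans (cong toℕ below≡above) above≡x+2)) (ℕ.m≢1+n+m x {1})
    where
    x+2<n : suc (suc x) < suc N
    x+2<n = s≤s (ℕ.≤∧≢⇒< (ℕ.s≤s⁻¹ (subst (_< suc N) π0≡ (Fin.toℕ<n (π ⟨$⟩ʳ zero)))) x+1≢N)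
    below above : Fin (suc N)
    below = fromℕ< (ℕ.<-trans (ℕ.n<1+n x) (ℕ.<-trans (ℕ.n<1+n (suc x)) x+2<n))
    above = fromℕ< x+2<n
    below≡x : toℕ below ≡ x
    below≡x = Fin.toℕ-fromℕ< _
    above≡x+2 : toℕ above ≡ suc (suc x)
    above≡x+2 = Fin.toℕ-fromℕ< x+2<n
    preimage≡1 : ∀ u → Adjacent (toℕ (π ⟨$⟩ʳ zero)) (toℕ u) → toℕ (π ⟨$⟩ˡ u) ≡ 1
    preimage≡1 u adj =
      adjacent-zero (subst (λ j → Adjacent (toℕ j) (toℕ (π ⟨$⟩ˡ u))) (inverseˡ π) (π⁻¹-adjacent adj))
    below≡above : below ≡ above
    below≡above = trans (sym (inverseʳ π)) (trans (cong (π ⟨$⟩ʳ_) (Fin.toℕ-injective (trans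
      (preimage≡1 below (inj₂ (trans π0≡ (cong suc (sym below≡x)))))
      (sym (preimage≡1 above (inj₁ (trans (cong suc π0≡) (sym above≡x+2)))))))) (inverseʳ π))

  path-classification : (π : Permutation′ (suc N)) →
                        PreservesAdjacency (π ⟨$⟩ʳ_) → PreservesAdjacency (π ⟨$⟩ˡ_) →
                        (∀ i → π ⟨$⟩ʳ i ≡ i) ⊎ (∀ i → π ⟨$⟩ʳ i ≡ opposite i)
  path-classification π π-adjacent π⁻¹-adjacent with path-endpoint π π⁻¹-adjacent
  ... | inj₁ π0≡0 = inj₁ (path-rigid (π ⟨$⟩ʳ_) (permutation-injective π) π-adjacent π0≡0)
  ... | inj₂ π0≡N = inj₂ λ i → opposite-injective (trans (reversed-rigid i) (sym (Fin.opposite-involutive i)))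
    where
    reversed-rigid : ∀ i → opposite (π ⟨$⟩ʳ i) ≡ i
    reversed-rigid = path-rigid (opposite ∘ (π ⟨$⟩ʳ_)) (permutation-injective π ∘ opposite-injective)
      (opposite-preservesAdjacency ∘ π-adjacent)
      (trans (Fin.opposite-prop (π ⟨$⟩ʳ zero)) (trans (cong (N ∸_) π0≡N) (ℕ.n∸n≡0 N)))

adjacent⇒≢ : ∀ {n} {a b : Fin n} → Adjacent (toℕ a) (toℕ b) → a ≢ b
adjacent⇒≢ adj refl = adjacent-irrefl adj

aut-FenceLe : ∀ {t n} (σ : Aut (fence t n)) a b →
              FenceLe t (toℕ a) (toℕ b) → FenceLe t (toℕ (app σ a)) (toℕ (app σ b))
aut-FenceLe (_ , σ-aut) a b = le-fence⇒ ∘ trans (σ-aut a b) ∘ le-fence⇐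

aut-preservesAdjacency : ∀ {t n} (σ : Aut (fence t n)) → PreservesAdjacency (app σ)
aut-preservesAdjacency {t} σ {a} {b} adj
  with comparable⇒≡⊎adjacent t (Data.Sum.map (aut-FenceLe σ a b) (aut-FenceLe σ b a) (adjacent⇒comparable t adj))
... | inj₁ σa≡σb = contradiction (permutation-injective (proj₁ σ) (Fin.toℕ-injective σa≡σb)) (adjacent⇒≢ adj)
... | inj₂ adj' = adj'

fence-automorphism : ∀ {t n} (σ : Aut (fence t n)) → (∀ i → app σ i ≡ i) ⊎ (∀ i → app σ i ≡ opposite i)
fence-automorphism {n = zero} _ = inj₁ λ ()
fence-automorphism {n = suc _} σ =
  path-classification (proj₁ σ) (aut-preservesAdjacency σ) (aut-preservesAdjacency (aut-inverse σ))

even-fence-rigid : ∀ {t n} → Even n → (σ : Aut (fence t n)) → ∀ i → app σ i ≡ i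
even-fence-rigid {n = zero} _ _ ()
even-fence-rigid {t} {suc (suc N)} even σ with fence-automorphism σ
... | inj₁ σ≡id = σ≡id
... | inj₂ σ≡opposite = contradiction (sym not-t≡t) (not-¬ refl)
  where
  open ≡-Reasoning
  n : ℕ
  n = suc (suc N)
  0F 1F : Fin n
  0F = zero
  1F = suc zero
  not-t≡t : not t ≡ t
  not-t≡t = begin
    not t                                                ≡⟨ xor-comm true t ⟩
    t xor true                                           ≡⟨ cong (t xor_) even ⟨
    t'                                                   ≡⟨ le-fence-0-1 t' N ⟨
    le (fence t' n) 0F 1F                                ≡⟨ cong₂ (le (fence t' n)) (involutive 0F) (involutive 1F) ⟨
    le (fence t' n) (opposite (opposite 0F)) (opposite (opposite 1F))
                                                         ≡⟨ le-fence-opposite t (opposite 0F) (opposite 1F) ⟩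
    le (fence t n) (opposite 0F) (opposite 1F)           ≡⟨ cong₂ (le (fence t n)) (σ≡opposite 0F) (σ≡opposite 1F) ⟨
    le (fence t n) (app σ 0F) (app σ 1F)                 ≡⟨ proj₂ σ 0F 1F ⟩
    le (fence t n) 0F 1F                                 ≡⟨ le-fence-0-1 t N ⟩
    t                                                    ∎
    where
    t' : Bool
    t' = t xor isEven n
    involutive : ∀ (i : Fin n) → opposite (opposite i) ≡ i
    involutive = Fin.opposite-involutive

∈-moved⇔ : ∀ {P} (σ : Aut P) x → x ∈ moved σ ⇔ app σ x ≢ x
∈-moved⇔ σ x = mk⇔
  (λ x∈ → isNo⇒¬ (app σ x Fin.≟ x) (trans (sym (Vec.lookup∘tabulate _ x)) (Vec.[]=⇒lookup x∈)))
  (λ σx≢x → Vec.lookup⇒[]= x _ (trans (Vec.lookup∘tabulate _ x) (¬⇒isNo (app σ x Fin.≟ x) σx≢x)))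
  where
  isNo⇒¬ : ∀ {A : Set} (d : Dec A) → not ⌊ d ⌋ ≡ true → ¬ A
  isNo⇒¬ (false because ofⁿ ¬a) _ = ¬a
  ¬⇒isNo : ∀ {A : Set} (d : Dec A) → ¬ A → not ⌊ d ⌋ ≡ true
  ¬⇒isNo (true because ofʸ a) ¬a = contradiction a ¬a
  ¬⇒isNo (false because _) _ = refl

rigid⇒locallyUnsymmetric : ∀ {P} → (∀ (σ : Aut P) x → app σ x ≡ x) → LocallyUnsymmetric P
rigid⇒locallyUnsymmetric {P} rigid (Q , r , _ , _ , a , b , a≢b , a~b) = a≢b (fold isEquivalence sym1⇒≡ a~b)
  where
  sym1⇒≡ : ∀ {x y} → Sym1 P Q r x y → x ≡ y
  sym1⇒≡ {x} (σ , _ , ((maxOrdered , _) , _) , (i , x∈Sᵢ) , _) =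
    contradiction (rigid σ x) (Equivalence.to (∈-moved⇔ σ x) (proj₁ (maxOrdered i) x∈Sᵢ))

-- Generators from involutions

sumFin-mono : ∀ n {f g : Fin n → ℕ} → (∀ i → f i ≤ g i) → sumFin n f ≤ sumFin n g
sumFin-mono zero _ = z≤n
sumFin-mono (suc n) f≤g = ℕ.+-mono-≤ (f≤g zero) (sumFin-mono n (f≤g ∘ suc))

orderedPairs-mono : ∀ P {A B : Subset (size P)} → A ⊆ B → orderedPairs P A ≤ orderedPairs P B
orderedPairs-mono P {A} {B} A⊆B =
  sumFin-mono _ λ a → sumFin-mono _ λ b → indicator-mono (lt P a b) (∈B a) (∈B b)
  where
  ∈B : ∀ x → lookup A x ≡ true → lookup B x ≡ true
  ∈B x = Vec.[]=⇒lookup ∘ A⊆B ∘ Vec.lookup⇒[]= x A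
  indicator-mono : ∀ {a a' b b'} c → (a ≡ true → a' ≡ true) → (b ≡ true → b' ≡ true) →
                   (if a ∧ b ∧ c then 1 else 0) ≤ (if a' ∧ b' ∧ c then 1 else 0)
  indicator-mono {false} _ _ _ = z≤n
  indicator-mono {true} {b = false} _ _ _ = z≤n
  indicator-mono {true} {b = true} _ a⇒a' b⇒b' rewrite a⇒a' refl | b⇒b' refl = ℕ.≤-refl

maxOrdered-refl : ∀ P (X : Subset (size P)) → MaxOrdered P X X
maxOrdered-refl P X = id , λ _ B⊆X _ → orderedPairs-mono P B⊆X

module _ (P : FinRel) (X : Subset (size P)) where

  ChainIn : Subset (size P) → Set
  ChainIn C = C ⊆ X × IsChain P C

  chainIn? : ∀ C → Dec (ChainIn C)
  chainIn? C = (C ⊆? X) ×-dec Fin.all? λ a → Fin.all? λ b →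
    (a ∈? C) →-dec ((b ∈? C) →-dec ((le P a b Bool.≟ true) ⊎-dec (le P b a Bool.≟ true)))

  height-below : ∀ d → (∀ C → ChainIn C → ∣ C ∣ ≤ d) → ∃[ h ] Height P X h
  height-below d bounded with anySubset? (λ C → chainIn? C ×-dec (∣ C ∣ ℕ.≟ d))
  ... | yes (C , (C⊆X , chain) , ∣C∣≡d) =
    d , (C , C⊆X , chain , ∣C∣≡d) , λ C' C'⊆X chain' → bounded C' (C'⊆X , chain')
  height-below zero bounded | no none =
    contradiction (⊥ , empty , ℕ.n≤0⇒n≡0 (bounded ⊥ empty)) none
    where
    empty : ChainIn ⊥
    empty = (λ x∈⊥ → contradiction x∈⊥ ∉⊥) , λ a _ a∈⊥ _ → contradiction a∈⊥ ∉⊥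
  height-below (suc d) bounded | no none =
    height-below d λ C chain → ℕ.s≤s⁻¹ (ℕ.≤∧≢⇒< (bounded C chain) (λ ∣C∣≡d+1 → none (C , chain , ∣C∣≡d+1)))

  height-exists : ∃[ h ] Height P X h
  height-exists = height-below (size P) λ C _ → ∣p∣≤n C

moved-closed : ∀ {P} (σ : Aut P) x → x ∈ moved σ ⇔ (∃[ y ] (y ∈ moved σ × app σ y ≡ x))
moved-closed σ@(π , _) x = mk⇔
  (λ x∈ → π ⟨$⟩ˡ x ,
          Equivalence.from (∈-moved⇔ σ _)
            (λ fixed → moved⇒ x∈ (trans (cong (π ⟨$⟩ʳ_) (sym (preimage≡x fixed))) (inverseʳ π))) ,
          inverseʳ π)
  (λ { (y , y∈ , σy≡x) → Equivalence.from (∈-moved⇔ σ x) λ σx≡x →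
         moved⇒ y∈ (trans σy≡x (permutation-injective π (trans σx≡x (sym σy≡x)))) })
  where
  moved⇒ : ∀ {z} → z ∈ moved σ → app σ z ≢ z
  moved⇒ = Equivalence.to (∈-moved⇔ σ _)
  preimage≡x : π ⟨$⟩ʳ (π ⟨$⟩ˡ x) ≡ π ⟨$⟩ˡ x → π ⟨$⟩ˡ x ≡ x
  preimage≡x fixed = trans (sym fixed) (inverseʳ π)

admissible-moved : ∀ {P} (σ : Aut P) r → Admissible P σ (suc r) (λ _ → moved σ)
admissible-moved {P} σ _ =
  (λ _ → maxOrdered-refl P (moved σ)) ,
  (λ _ → moved-closed σ) ,
  (λ _ → proj₁ height , proj₂ height , proj₂ height) ,
  (λ _ x∈ → zero , x∈)
  where
  height : ∃[ h ] Height P (moved σ) h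
  height = height-exists P (moved σ)

-- As 3 is odd, σ² = id turns four steps around the cycle into x ∈ S j → x ∈ S (cyc j),
-- so all members of the family coincide and each contains Σ(σ).
involution-admissible-⊇ : ∀ {P} (σ : Aut P) → (∀ x → app σ (app σ x) ≡ x) →
                          ∀ {S} → Admissible P σ 3 S → ∀ i → moved σ ⊆ S i
involution-admissible-⊇ σ involutive {S} (_ , closed , _ , covered) i x∈ with covered _ x∈
... | j , x∈Sⱼ = from-zero i (to-zero j x∈Sⱼ)
  where
  step : ∀ j {x} → x ∈ S j → app σ x ∈ S (cyc j)
  step j {x} x∈Sⱼ = Equivalence.from (closed j (app σ x)) (x , x∈Sⱼ , refl)
  step² : ∀ j {x} → x ∈ S j → x ∈ S (cyc (cyc j))
  step² j {x} x∈Sⱼ = subst (_∈ S (cyc (cyc j))) (involutive x) (step (cyc j) (step j x∈Sⱼ))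
  cyc³ : ∀ (j : Fin 3) → cyc (cyc (cyc j)) ≡ j
  cyc³ zero = refl
  cyc³ (suc zero) = refl
  cyc³ (suc (suc zero)) = refl
  next : ∀ j {x} → x ∈ S j → x ∈ S (cyc j)
  next j {x} x∈Sⱼ = subst (λ l → x ∈ S (cyc l)) (cyc³ j) (step² (cyc (cyc j)) (step² j x∈Sⱼ))
  to-zero : ∀ j {x} → x ∈ S j → x ∈ S zero
  to-zero zero x∈ = x∈
  to-zero (suc zero) x∈ = next (suc (suc zero)) (next (suc zero) x∈)
  to-zero (suc (suc zero)) x∈ = next (suc (suc zero)) x∈
  from-zero : ∀ i {x} → x ∈ S zero → x ∈ S i
  from-zero zero x∈ = x∈
  from-zero (suc zero) x∈ = next zero x∈
  from-zero (suc (suc zero)) x∈ = next (suc zero) (next zero x∈)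

induced : (P : FinRel) {m : ℕ} → (Fin m → Elem P) → FinRel
induced P {m} g = mkFinRel m λ a b → le P (g a) (g b)

induced-isPoset : ∀ P {m} (g : Fin m → Elem P) → IsPoset P → Injective _≡_ _≡_ g → IsPoset (induced P g)
induced-isPoset P g (reflexive , antisymmetric , transitive) g-injective =
  (λ a → reflexive (g a)) ,
  (λ a b a≤b b≤a → g-injective (antisymmetric (g a) (g b) a≤b b≤a)) ,
  (λ a b c → transitive (g a) (g b) (g c))

iter-invariant : ∀ {P} {A : Set} (h : Elem P → A) (σ : Aut P) → (∀ x → h (app σ x) ≡ h x) →
                 ∀ q x → h (iter σ q x) ≡ h x
iter-invariant _ _ _ zero _ = refl
iter-invariant h σ invariant (suc q) x = trans (invariant (iter σ q x)) (iter-invariant h σ invariant q x)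

-- Folding an odd fence

double-injective : ∀ {x y} → x + x ≡ y + y → x ≡ y
double-injective {x} {y} e with ℕ.<-cmp x y
... | tri< x<y _ _ = contradiction e (ℕ.<⇒≢ (ℕ.+-mono-< x<y x<y))
... | tri≈ _ x≡y _ = x≡y
... | tri> _ _ y<x = contradiction (sym e) (ℕ.<⇒≢ (ℕ.+-mono-< y<x y<x))

≤-half⇒half-≤ : ∀ {k x y} → x + y ≡ k + k → x ≤ k → k ≤ y
≤-half⇒half-≤ e x≤k = ℕ.≮⇒≥ λ y<k → ℕ.<-irrefl e (ℕ.+-mono-≤-< x≤k y<k)

half-≤⇒≤-half : ∀ {k x y} → x + y ≡ k + k → k ≤ x → y ≤ k
half-≤⇒≤-half e k≤x = ℕ.≮⇒≥ λ k<y → ℕ.<-irrefl (sym e) (ℕ.+-mono-≤-< k≤x k<y)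

straddle : ∀ {k x y} → x ≤ k → k ≤ y → x ≡ y ⊎ Adjacent x y → x ≡ k ⊎ y ≡ k
straddle x≤k k≤y (inj₁ refl) = inj₁ (ℕ.≤-antisym x≤k k≤y)
straddle x≤k k≤y (inj₂ (inj₁ refl)) with ℕ.m≤n⇒m<n∨m≡n x≤k
... | inj₁ x<k = inj₂ (ℕ.≤-antisym x<k k≤y)
... | inj₂ x≡k = inj₁ x≡k
straddle x≤k k≤y (inj₂ (inj₂ refl)) = contradiction (ℕ.≤-trans x≤k k≤y) ℕ.1+n≰n

module Fold (t : Bool) (k : ℕ) where

  n : ℕ
  n = suc (k + k)

  P P' : FinRel
  P = fence t n
  P' = fence t (suc k)

  toℕ+toℕ-opposite : ∀ (i : Fin n) → toℕ i + toℕ (opposite i) ≡ k + k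
  toℕ+toℕ-opposite i = ℕ.suc-injective (suc-toℕ+toℕ-opposite i)

  reverse-isAut : IsAut P Perm.reverse
  reverse-isAut i j =
    trans (cong (λ s → le (fence s n) (opposite i) (opposite j)) (sym same-type)) (le-fence-opposite t i j)
    where
    same-type : t xor isEven n ≡ t
    same-type = trans (cong (t xor_) (trans (isEven-suc (k + k)) (cong not (even-double k)))) (xor-identityʳ t)

  ρ : Aut P
  ρ = Perm.reverse , reverse-isAut

  mid : Fin n
  mid = fromℕ< (s≤s (ℕ.m≤m+n k k))

  toℕ-mid : toℕ mid ≡ k
  toℕ-mid = Fin.toℕ-fromℕ< _

  opposite-fixed⇔ : ∀ x → opposite x ≡ x ⇔ x ≡ mid
  opposite-fixed⇔ x = mk⇔
    (λ fixed → Fin.toℕ-injective (trans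
      (double-injective (subst (λ y → toℕ x + toℕ y ≡ k + k) fixed (toℕ+toℕ-opposite x))) (sym toℕ-mid)))
    (λ { refl → Fin.toℕ-injective (trans (ℕ.+-cancelˡ-≡ k _ _
      (subst (λ y → y + toℕ (opposite mid) ≡ k + k) toℕ-mid (toℕ+toℕ-opposite mid))) (sym toℕ-mid)) })

  ∈-movedρ⇔ : ∀ x → x ∈ moved ρ ⇔ x ≢ mid
  ∈-movedρ⇔ x = mk⇔
    (λ x∈ → Equivalence.to (∈-moved⇔ ρ x) x∈ ∘ Equivalence.from (opposite-fixed⇔ x))
    (λ x≢mid → Equivalence.from (∈-moved⇔ ρ x) (x≢mid ∘ Equivalence.to (opposite-fixed⇔ x)))

  ∣movedρ∣ : ∣ moved ρ ∣ ≡ k + k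
  ∣movedρ∣ = begin
    ∣ moved ρ ∣        ≡⟨ cong ∣_∣ movedρ≡ ⟩
    ∣ ∁ ⁅ mid ⁆ ∣      ≡⟨ ∣∁p∣≡n∸∣p∣ ⁅ mid ⁆ ⟩
    n ∸ ∣ ⁅ mid ⁆ ∣    ≡⟨ cong (n ∸_) (∣⁅x⁆∣≡1 mid) ⟩
    k + k              ∎
    where
    open ≡-Reasoning
    movedρ≡ : moved ρ ≡ ∁ ⁅ mid ⁆
    movedρ≡ = ⊆-antisym
      (λ x∈ → x∉p⇒x∈∁p (Equivalence.to (∈-movedρ⇔ _) x∈ ∘ x∈⁅y⁆⇒x≡y mid))
      (λ x∈ → Equivalence.from (∈-movedρ⇔ _) λ { refl → x∈∁p⇒x∉p x∈ (x∈⁅x⁆ mid) })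

  Q : FinRel
  Q = induced P (punchIn mid)

  ρ-generator : IsGenerator P Q 3 ρ (λ _ → moved ρ)
  ρ-generator =
    admissible-moved ρ 2 ,
    (λ _ → punchIn mid , Fin.punchIn-injective mid _ _ , image , λ _ _ → refl) ,
    minimal
    where
    image : ∀ x → x ∈ moved ρ ⇔ (∃[ y ] punchIn mid y ≡ x)
    image x = mk⇔
      (λ x∈ → punchOut (Equivalence.to (∈-movedρ⇔ x) x∈ ∘ sym) , Fin.punchIn-punchOut _)
      (λ { (y , refl) → Equivalence.from (∈-movedρ⇔ _) (Fin.punchInᵢ≢i mid y) })
    minimal : ∀ S → Admissible P ρ 3 S → ∀ i → k + k ≤ ∣ S i ∣
    minimal S admissible i =
      subst (_≤ ∣ S i ∣) ∣movedρ∣ (p⊆q⇒∣p∣≤∣q∣ (involution-admissible-⊇ ρ Fin.opposite-involutive admissible i))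

  ρ-sym1 : ∀ {x} → x ∈ moved ρ → Sym1 P Q 3 x (opposite x)
  ρ-sym1 x∈ = ρ , (λ _ → moved ρ) , ρ-generator , (zero , x∈) , (1 , ℕ.≤-refl , s≤s (s≤s z≤n) , refl)

  ⊓-low : ∀ i → toℕ i ≤ k → toℕ i ⊓ toℕ (opposite i) ≡ toℕ i
  ⊓-low i i≤k = ℕ.m≤n⇒m⊓n≡m (ℕ.≤-trans i≤k (≤-half⇒half-≤ (toℕ+toℕ-opposite i) i≤k))

  ⊓-high : ∀ i → k ≤ toℕ i → toℕ i ⊓ toℕ (opposite i) ≡ toℕ (opposite i)
  ⊓-high i k≤i = ℕ.m≥n⇒m⊓n≡n (ℕ.≤-trans (half-≤⇒≤-half (toℕ+toℕ-opposite i) k≤i) k≤i)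

  collapse : Fin n → Fin (suc k)
  collapse i = fromℕ< (s≤s bound)
    where
    bound : toℕ i ⊓ toℕ (opposite i) ≤ k
    bound with ℕ.≤-total (toℕ i) k
    ... | inj₁ i≤k = subst (_≤ k) (sym (⊓-low i i≤k)) i≤k
    ... | inj₂ k≤i = subst (_≤ k) (sym (⊓-high i k≤i)) (half-≤⇒≤-half (toℕ+toℕ-opposite i) k≤i)

  toℕ-collapse : ∀ i → toℕ (collapse i) ≡ toℕ i ⊓ toℕ (opposite i)
  toℕ-collapse i = Fin.toℕ-fromℕ< _

  collapse-low : ∀ i → toℕ i ≤ k → toℕ (collapse i) ≡ toℕ i
  collapse-low i i≤k = trans (toℕ-collapse i) (⊓-low i i≤k)

  collapse-high : ∀ i → k ≤ toℕ i → toℕ (collapse i) ≡ toℕ (opposite i)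
  collapse-high i k≤i = trans (toℕ-collapse i) (⊓-high i k≤i)

  collapse-opposite : ∀ i → collapse (opposite i) ≡ collapse i
  collapse-opposite i = Fin.toℕ-injective (begin
    toℕ (collapse (opposite i))                     ≡⟨ toℕ-collapse (opposite i) ⟩
    toℕ (opposite i) ⊓ toℕ (opposite (opposite i))  ≡⟨ cong ((toℕ (opposite i) ⊓_) ∘ toℕ) (Fin.opposite-involutive i) ⟩
    toℕ (opposite i) ⊓ toℕ i                        ≡⟨ ℕ.⊓-comm (toℕ (opposite i)) (toℕ i) ⟩
    toℕ i ⊓ toℕ (opposite i)                        ≡⟨ toℕ-collapse i ⟨
    toℕ (collapse i)                                ∎)
    where open ≡-Reasoning

  collapse-fibre : ∀ {a b} → collapse a ≡ collapse b → b ≡ a ⊎ b ≡ opposite a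
  collapse-fibre {a} {b} e = fibre (ℕ.⊓-sel (toℕ a) (toℕ (opposite a))) (ℕ.⊓-sel (toℕ b) (toℕ (opposite b)))
    where
    same : ∀ {u w} → toℕ a ⊓ toℕ (opposite a) ≡ toℕ u → toℕ b ⊓ toℕ (opposite b) ≡ toℕ w → w ≡ u
    same ea eb = Fin.toℕ-injective (begin
      toℕ _                       ≡⟨ eb ⟨
      toℕ b ⊓ toℕ (opposite b)    ≡⟨ toℕ-collapse b ⟨
      toℕ (collapse b)            ≡⟨ cong toℕ e ⟨
      toℕ (collapse a)            ≡⟨ toℕ-collapse a ⟩
      toℕ a ⊓ toℕ (opposite a)    ≡⟨ ea ⟩
      toℕ _                       ∎)
      where open ≡-Reasoning
    fibre : toℕ a ⊓ toℕ (opposite a) ≡ toℕ a ⊎ toℕ a ⊓ toℕ (opposite a) ≡ toℕ (opposite a) →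
            toℕ b ⊓ toℕ (opposite b) ≡ toℕ b ⊎ toℕ b ⊓ toℕ (opposite b) ≡ toℕ (opposite b) →
            b ≡ a ⊎ b ≡ opposite a
    fibre (inj₁ ea) (inj₁ eb) = inj₁ (same ea eb)
    fibre (inj₁ ea) (inj₂ eb) = inj₂ (opposite-injective (trans (same ea eb) (sym (Fin.opposite-involutive a))))
    fibre (inj₂ ea) (inj₁ eb) = inj₂ (same ea eb)
    fibre (inj₂ ea) (inj₂ eb) = inj₁ (opposite-injective (same ea eb))

  collapse-branch : ∀ {a b} → toℕ a ≡ toℕ b ⊎ Adjacent (toℕ a) (toℕ b) →
    (toℕ (collapse a) ≡ toℕ a × toℕ (collapse b) ≡ toℕ b) ⊎
    (toℕ (collapse a) ≡ toℕ (opposite a) × toℕ (collapse b) ≡ toℕ (opposite b))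
  collapse-branch {a} {b} near with ℕ.≤-total (toℕ a) k | ℕ.≤-total (toℕ b) k
  ... | inj₁ a≤k | inj₁ b≤k = inj₁ (collapse-low a a≤k , collapse-low b b≤k)
  ... | inj₂ k≤a | inj₂ k≤b = inj₂ (collapse-high a k≤a , collapse-high b k≤b)
  ... | inj₁ a≤k | inj₂ k≤b with straddle a≤k k≤b near
  ...   | inj₁ a≡k = inj₂ (collapse-high a (ℕ.≤-reflexive (sym a≡k)) , collapse-high b k≤b)
  ...   | inj₂ b≡k = inj₁ (collapse-low a a≤k , collapse-low b (ℕ.≤-reflexive b≡k))
  collapse-branch {a} {b} near | inj₂ k≤a | inj₁ b≤k with straddle b≤k k≤a (Data.Sum.map sym adjacent-sym near)
  ...   | inj₁ b≡k = inj₂ (collapse-high a k≤a , collapse-high b (ℕ.≤-reflexive (sym b≡k)))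
  ...   | inj₂ a≡k = inj₁ (collapse-low a (ℕ.≤-reflexive a≡k) , collapse-low b b≤k)

  collapse-mono : ∀ a b → le P a b ≡ true → le P' (collapse a) (collapse b) ≡ true
  collapse-mono a b a≤b with collapse-branch (comparable⇒≡⊎adjacent t (inj₁ (le-fence⇒ a≤b)))
  ... | inj₁ (ea , eb) = trans (le-fence-cong t {i = collapse a} {collapse b} {a} {b} ea eb) a≤b
  ... | inj₂ (ea , eb) = trans (le-fence-cong t {i = collapse a} {collapse b} {opposite a} {opposite b} ea eb)
                               (trans (reverse-isAut a b) a≤b)

  collapse-invariant : ∀ (σ : Aut P) x → collapse (app σ x) ≡ collapse x
  collapse-invariant σ x with fence-automorphism σ
  ... | inj₁ σ≡id = cong collapse (σ≡id x)
  ... | inj₂ σ≡opposite = trans (cong collapse (σ≡opposite x)) (collapse-opposite x)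

  sym1⇒collapse≡ : ∀ {R r x y} → Sym1 P R r x y → collapse x ≡ collapse y
  sym1⇒collapse≡ {x = x} (σ , _ , _ , _ , q , _ , _ , σ^q[x]≡y) =
    trans (sym (iter-invariant collapse σ (collapse-invariant σ) q x)) (cong collapse σ^q[x]≡y)

  collapse≡⇔QSym : ∀ a b → collapse a ≡ collapse b ⇔ QSym P Q 3 a b
  collapse≡⇔QSym a b = mk⇔ to (fold (On.isEquivalence collapse isEquivalence) sym1⇒collapse≡)
    where
    to : collapse a ≡ collapse b → QSym P Q 3 a b
    to e with collapse-fibre e | opposite a Fin.≟ a
    ... | inj₁ refl | _ = ε
    ... | inj₂ refl | yes fixed = subst (QSym P Q 3 a) (sym fixed) ε
    ... | inj₂ refl | no moves = fwd (ρ-sym1 (Equivalence.from (∈-moved⇔ ρ a) moves)) ◅ ε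

  embed : Fin (suc k) → Fin n
  embed y = inject≤ y (s≤s (ℕ.m≤m+n k k))

  toℕ-embed : ∀ y → toℕ (embed y) ≡ toℕ y
  toℕ-embed y = Fin.toℕ-inject≤ y _

  collapse-embed : ∀ y → collapse (embed y) ≡ y
  collapse-embed y = Fin.toℕ-injective (trans (collapse-low (embed y) y≤k) (toℕ-embed y))
    where
    y≤k : toℕ (embed y) ≤ k
    y≤k = subst (_≤ k) (sym (toℕ-embed y)) (ℕ.s≤s⁻¹ (Fin.toℕ<n y))

  collapse-le⇔ : ∀ a b → le P' (collapse a) (collapse b) ≡ true ⇔
                 (∃[ a' ] ∃[ b' ] (collapse a' ≡ collapse a × collapse b' ≡ collapse b × le P a' b' ≡ true))
  collapse-le⇔ a b = mk⇔
    (λ a≤b → embed (collapse a) , embed (collapse b) , collapse-embed _ , collapse-embed _ ,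
             trans (le-fence-cong t {i = embed (collapse a)} {embed (collapse b)} (toℕ-embed _) (toℕ-embed _)) a≤b)
    (λ { (a' , b' , ea , eb , a'≤b') → subst₂ (λ u v → le P' u v ≡ true) ea eb (collapse-mono a' b' a'≤b') })

  retractStep : 0 < k → RetractStep P P'
  retractStep 0<k =
    Q , 3 , induced-isPoset P (punchIn mid) (fence-isPoset t n) (Fin.punchIn-injective mid _ _) ,
    s≤s (s≤s z≤n) , nontrivial ,
    collapse , (λ y → embed y , collapse-embed y) , collapse≡⇔QSym , collapse-le⇔
    where
    zero-moves : zero ∈ moved ρ
    zero-moves = Equivalence.from (∈-movedρ⇔ zero) λ zero≡mid → ℕ.<⇒≢ 0<k (trans (cong toℕ zero≡mid) toℕ-mid)
    nontrivial : Nontrivial P Q 3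
    nontrivial =
      zero , opposite zero , Equivalence.to (∈-moved⇔ ρ zero) zero-moves ∘ sym , fwd (ρ-sym1 zero-moves) ◅ ε

-- Iterating the fold

even-fence-iso : ∀ t {n} → Even n → Iso (fence t n) (fence true n)
even-fence-iso true _ = id , id , (λ y → y , refl) , λ _ _ → refl
even-fence-iso false {n} even =
  opposite , opposite-injective , (λ y → opposite y , Fin.opposite-involutive y) ,
  λ i j → subst (λ s → le (fence s n) (opposite i) (opposite j) ≡ le (fence false n) i j) even
                (le-fence-opposite false i j)

retractStep-iso : ∀ {P P' P''} → RetractStep P P' → Iso P' P'' → RetractStep P P''
retractStep-iso {P} {P'' = P''} (Q , r , Q-poset , 2≤r , nontrivial , π , π-onto , π-kernel , π-le)
                    (g , g-injective , g-onto , g-le) =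
  Q , r , Q-poset , 2≤r , nontrivial , g ∘ π , onto , kernel , le⇔
  where
  onto : ∀ y → ∃[ x ] g (π x) ≡ y
  onto y with g-onto y
  ... | y' , gy'≡y with π-onto y'
  ... | x , πx≡y' = x , trans (cong g πx≡y') gy'≡y
  kernel : ∀ a b → g (π a) ≡ g (π b) ⇔ QSym P Q r a b
  kernel a b = mk⇔ (Equivalence.to (π-kernel a b) ∘ g-injective) (cong g ∘ Equivalence.from (π-kernel a b))
  le⇔ : ∀ a b → le P'' (g (π a)) (g (π b)) ≡ true ⇔
                (∃[ a' ] ∃[ b' ] (g (π a') ≡ g (π a) × g (π b') ≡ g (π b) × le P a' b' ≡ true))
  le⇔ a b = mk⇔
    (λ l → let (a' , b' , ea , eb , a'≤b') = Equivalence.to (π-le a b) (trans (sym (g-le (π a) (π b))) l)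
           in a' , b' , cong g ea , cong g eb , a'≤b')
    (λ { (a' , b' , ea , eb , a'≤b') →
           trans (g-le (π a) (π b)) (Equivalence.from (π-le a b) (a' , b' , g-injective ea , g-injective eb , a'≤b')) })

iso⇒size≤ : ∀ {P R} → Iso P R → size P ≤ size R
iso⇒size≤ (_ , g-injective , _) = Fin.injective⇒≤ g-injective

⌊double/2⌋ : ∀ k → ⌊ k + k /2⌋ ≡ k
⌊double/2⌋ zero = refl
⌊double/2⌋ (suc k) rewrite ℕ.+-suc k k = cong suc (⌊double/2⌋ k)

f-odd : ∀ k → f (suc (k + k)) ≡ suc k
f-odd k rewrite isEven-suc (k + k) | even-double k = cong suc (⌊double/2⌋ k)

fIter-f : ∀ j n → fIter j (f n) ≡ fIter (suc j) n
fIter-f zero _ = refl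
fIter-f (suc j) n = cong f (fIter-f j n)

isFDown-stop : ∀ {n m} → f n ≡ m → Even m → IsFDown n m
isFDown-stop refl even = 0 , refl , even , λ _ ()

isFDown-continue : ∀ {n m} → Odd (f n) → IsFDown (f n) m → IsFDown n m
isFDown-continue {n} odd (j , m≡ , even , odds) = suc j , trans m≡ (fIter-f (suc j) n) , even , odds'
  where
  odds' : ∀ i → i < suc j → Odd (fIter (suc i) n)
  odds' zero _ = odd
  odds' (suc i) i<j = subst Odd (fIter-f (suc i) n) (odds i (ℕ.s≤s⁻¹ i<j))

3≤double+1⇒0< : ∀ k → 3 ≤ suc (k + k) → 0 < k
3≤double+1⇒0< zero (s≤s ())
3≤double+1⇒0< (suc _) _ = s≤s z≤n

suc<double+1 : ∀ {k} → 0 < k → suc k < suc (k + k)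
suc<double+1 {k} 0<k = s≤s (ℕ.m<m+n k 0<k)

odd⇒3≤ : ∀ {k} → 0 < k → Odd (suc k) → 3 ≤ suc k
odd⇒3≤ {suc zero} _ ()
odd⇒3≤ {suc (suc _)} _ _ = s≤s (s≤s (s≤s z≤n))

RetractsToFDown : Bool → ℕ → Set
RetractsToFDown t n = ∃[ m ] (IsFDown n m × m < n × TransClosure RetractStep (fence t n) (fence true m))

odd-fence-retracts : ∀ t n → 3 ≤ n → Odd n → RetractsToFDown t n
odd-fence-retracts t = <-rec (λ n → 3 ≤ n → Odd n → RetractsToFDown t n) go
  where
  fold-step : ∀ k → 0 < k → (∀ {m} → m < suc (k + k) → 3 ≤ m → Odd m → RetractsToFDown t m) →
              RetractsToFDown t (suc (k + k))
  fold-step k 0<k rec with isEven (suc k) in parity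
  ... | true =
    suc k , isFDown-stop (f-odd k) parity , suc<double+1 0<k ,
    [ retractStep-iso {P'' = fence true (suc k)} (Fold.retractStep t k 0<k) (even-fence-iso t parity) ]
  ... | false with rec (suc<double+1 0<k) (odd⇒3≤ 0<k parity) parity
  ...   | m , m-fdown , m<k+1 , chain =
    m , isFDown-continue (subst Odd (sym (f-odd k)) parity) (subst (λ x → IsFDown x m) (sym (f-odd k)) m-fdown) ,
    ℕ.<-trans m<k+1 (suc<double+1 0<k) , Fold.retractStep t k 0<k ∷ chain

  go : ∀ n → (∀ {m} → m < n → 3 ≤ m → Odd m → RetractsToFDown t m) → 3 ≤ n → Odd n → RetractsToFDown t n
  go n rec 3≤n odd with odd⇒double+1 n odd
  ... | k , refl = fold-step k (3≤double+1⇒0< k 3≤n) rec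

odd-fence-retractable : ∀ t n → 3 ≤ n → Odd n → ∃[ m ] (IsFDown n m × Retractable (fence t n) (fence true m))
odd-fence-retractable t n 3≤n odd with odd-fence-retracts t n 3≤n odd
... | m , m-fdown , m<n , chain = m , m-fdown , chain , λ iso → ℕ.<⇒≱ m<n (iso⇒size≤ {R = fence true m} iso)

mainTheorem8 :
    ((isLower : Bool) (n : ℕ) → Even n → LocallyUnsymmetric (fence isLower n)) ×
    ((isLower : Bool) (n : ℕ) → 3 ≤ n → Odd n →
       ∃[ m ] (IsFDown n m × Retractable (fence isLower n) (fence true m)))
mainTheorem8 = (λ t n even → rigid⇒locallyUnsymmetric (even-fence-rigid even)) , odd-fence-retractable
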